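{- For each pair $(\mathsf{G1ML},\mathsf{ML})$ among the fourteen pairs listed in the context and every formula $A$, the sequent $\Rightarrow A$ is derivable in $\mathsf{G1ML}$ if and only if $A$ is derivable in $\mathsf{ML}$.
   Context: Formulas: $A ::= p \mid \bot \mid A\wedge A \mid A\vee A \mid A\to A \mid \Box A \mid \Diamond A$; $\top:=\bot\to\bot$. $\mathsf{MPL}$: axioms $A\wedge B\to A$, $A\wedge B\to B$, $A\to A\vee B$, $B\to A\vee B$, $(A\to B)\to((A\to C)\to(A\to B\wedge C))$, $(A\to C)\to((B\to C)\to(A\vee B\to C))$, $(A\to(B\to C))\to((A\to B)\to(A\to C))$, $A\to(B\to A)$, rule modus ponens. Axiomatic modal principles: Mon$\Box$: rule $A\to B/\Box A\to\Box B$; Mon$\Diamond$: rule $A\to B/\Diamond A\to\Diamond B$; N$\Box$: $\Box\top$; C$\Box$: $\Box A\wedge\Box B\to\Box(A\wedge B)$; K$\Diamond$: $\Box(A\to B)\to(\Diamond A\to\Diamond B)$; P$\Diamond$: $\Diamond\top$; D: $\Box A\to\Diamond A$; T$\Box$: $\Box A\to A$; T$\Diamond$: $A\to\Diamond A$. $\mathsf{MM}=\mathsf{MPL}$+Mon$\Box$+Mon$\Diamond$; $\mathsf{MMP}=\mathsf{MM}$+P$\Diamond$; $\mathsf{MMN}=\mathsf{MM}$+N$\Box$; $\mathsf{MMNP}=\mathsf{MMN}$+P$\Diamond$; $\mathsf{MMC}=\mathsf{MM}$+C$\Box$+K$\Diamond$; $\mathsf{MK}=\mathsf{MMC}$+N$\Box$;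 $\mathsf{MMD}=\mathsf{MM}$+D+P$\Diamond$; $\mathsf{MMT}=\mathsf{MM}$+T$\Box$+T$\Diamond$; $\mathsf{MMND}=\mathsf{MMN}$+D; $\mathsf{MMNT}=\mathsf{MMN}$+T$\Box$+T$\Diamond$; $\mathsf{MMCD}=\mathsf{MMC}$+D+P$\Diamond$; $\mathsf{MMCT}=\mathsf{MMC}$+T$\Box$+T$\Diamond$; $\mathsf{MKD}=\mathsf{MK}$+D; $\mathsf{MKT}=\mathsf{MK}$+T$\Box$+T$\Diamond$. Sequents $\Gamma\Rightarrow C$ ($\Gamma$ finite multiset, $C$ a formula); $\Box\Sigma$ prefixes $\Box$ to each member of $\Sigma$; derivations are finite trees. $\mathsf{G1MPL}$: initial sequents $A\Rightarrow A$; (L$\wedge$) $\Gamma,A_i\Rightarrow C$ / $\Gamma,A_1\wedge A_2\Rightarrow C$; (R$\wedge$) $\Gamma\Rightarrow A$, $\Gamma\Rightarrow B$ / $\Gamma\Rightarrow A\wedge B$; (L$\vee$) $\Gamma,A\Rightarrow C$, $\Gamma,B\Rightarrow C$ / $\Gamma,A\vee B\Rightarrow C$; (R$\vee$) $\Gamma\Rightarrow A_i$ / $\Gamma\Rightarrow A_1\vee A_2$; (R$\to$) $\Gamma,A\Rightarrow B$ / $\Gamma\Rightarrow A\to B$; (L$\to$) $\Gamma\Rightarrow A$, $\Gamma,B\Rightarrow C$ / $\Gamma,A\to B\Rightarrow C$; (LW) $\Gamma\Rightarrow C$ / $\Gamma,A\Rightarrow C$; (LC) $\Gamma,A,A\Rightarrow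 C$ / $\Gamma,A\Rightarrow C$. Sequent modal rules: (M$\Box$) $A\Rightarrow B$ / $\Box A\Rightarrow\Box B$; (M$\Diamond$) $A\Rightarrow B$ / $\Diamond A\Rightarrow\Diamond B$; (N$\Box$) $\Rightarrow A$ / $\Rightarrow\Box A$; (C$\Box$) $\Sigma,A\Rightarrow B$ / $\Box\Sigma,\Box A\Rightarrow\Box B$; (K$\Box$) $\Sigma\Rightarrow A$ / $\Box\Sigma\Rightarrow\Box A$; (K$\Diamond$) $\Sigma,A\Rightarrow B$ / $\Box\Sigma,\Diamond A\Rightarrow\Diamond B$; (P$\Diamond$) $\Rightarrow A$ / $\Rightarrow\Diamond A$; (D) $A\Rightarrow B$ / $\Box A\Rightarrow\Diamond B$; (CD) $\Sigma\Rightarrow A$ / $\Box\Sigma\Rightarrow\Diamond A$; (T$\Box$) $\Gamma,A\Rightarrow C$ / $\Gamma,\Box A\Rightarrow C$; (T$\Diamond$) $\Gamma\Rightarrow A$ / $\Gamma\Rightarrow\Diamond A$. Calculi ($\mathsf{G1MPL}$ plus): $\mathsf{G1MM}$: M$\Box$,M$\Diamond$; $\mathsf{G1MMP}$: $\mathsf{G1MM}$+P$\Diamond$; $\mathsf{G1MMN}$: $\mathsf{G1MM}$+N$\Box$; $\mathsf{G1MMNP}$: $\mathsf{G1MMN}$+P$\Diamond$; $\mathsf{G1MMC}$: C$\Box$,K$\Diamond$; $\mathsf{G1MK}$: K$\Box$,K$\Diamond$; $\mathsf{G1MMD}$: $\mathsf{G1MM}$+D+P$\Diamond$; $\mathsf{G1MMT}$: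 $\mathsf{G1MM}$+T$\Box$+T$\Diamond$; $\mathsf{G1MMND}$: $\mathsf{G1MMN}$+D+P$\Diamond$; $\mathsf{G1MMNT}$: $\mathsf{G1MMN}$+T$\Box$+T$\Diamond$; $\mathsf{G1MMCD}$: $\mathsf{G1MMC}$+CD; $\mathsf{G1MMCT}$: $\mathsf{G1MMC}$+T$\Box$+T$\Diamond$; $\mathsf{G1MKD}$: $\mathsf{G1MK}$+CD; $\mathsf{G1MKT}$: $\mathsf{G1MK}$+T$\Box$+T$\Diamond$. The pairs are $(\mathsf{G1MX},\mathsf{MX})$ with matching names. -}

module Defs where

open import Data.Nat using (ℕ)
open import Data.List using (List; []; _∷_; map)
open import Data.List.Relation.Binary.Permutation.Propositional using (_↭_)
open import Data.Empty using (⊥)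
open import Data.Unit using () renaming (⊤ to Unit)

infixr 6 _∧'_
infixr 5 _∨'_
infixr 4 _⇒'_
data Formula : Set where
  var  : ℕ → Formula
  ⊥'   : Formula
  _∧'_ : Formula → Formula → Formula
  _∨'_ : Formula → Formula → Formula
  _⇒'_ : Formula → Formula → Formula
  □    : Formula → Formula
  ◇    : Formula → Formula

⊤' : Formula
⊤' = ⊥' ⇒' ⊥'

-- The fourteen pairs (G1MX, MX), indexed by the common name X.
data Logic : Set where
  MM MMP MMN MMNP MMC MK MMD MMT MMND MMNT MMCD MMCT MKD MKT : Logic

hasN hasP hasC hasD hasT : Logic → Set
hasN MMN = Unit
hasN MMNP = Unit
hasN MK = Unit
hasN MMND = Unit
hasN MMNT = Unit
hasN MKD = Unit
hasN MKT = Unit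
hasN _ = ⊥

hasP MMP = Unit
hasP MMNP = Unit
hasP MMD = Unit
hasP MMCD = Unit
hasP _ = ⊥

hasC MMC = Unit
hasC MK = Unit
hasC MMCD = Unit
hasC MMCT = Unit
hasC MKD = Unit
hasC MKT = Unit
hasC _ = ⊥

hasD MMD = Unit
hasD MMND = Unit
hasD MMCD = Unit
hasD MKD = Unit
hasD _ = ⊥

hasT MMT = Unit
hasT MMNT = Unit
hasT MMCT = Unit
hasT MKT = Unit
hasT _ = ⊥

data Hilbert (L : Logic) : Formula → Set where
  ax1 : ∀ A B → Hilbert L (A ∧' B ⇒' A)
  ax2 : ∀ A B → Hilbert L (A ∧' B ⇒' B)
  ax3 : ∀ A B → Hilbert L (A ⇒' A ∨' B)
  ax4 : ∀ A B → Hilbert L (B ⇒' A ∨' B)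
  ax5 : ∀ A B C → Hilbert L ((A ⇒' B) ⇒' ((A ⇒' C) ⇒' (A ⇒' B ∧' C)))
  ax6 : ∀ A B C → Hilbert L ((A ⇒' C) ⇒' ((B ⇒' C) ⇒' (A ∨' B ⇒' C)))
  ax7 : ∀ A B C → Hilbert L ((A ⇒' (B ⇒' C)) ⇒' ((A ⇒' B) ⇒' (A ⇒' C)))
  ax8 : ∀ A B → Hilbert L (A ⇒' (B ⇒' A))
  mp  : ∀ {A B} → Hilbert L (A ⇒' B) → Hilbert L A → Hilbert L B
  mon□ : ∀ {A B} → Hilbert L (A ⇒' B) → Hilbert L (□ A ⇒' □ B)
  mon◇ : ∀ {A B} → Hilbert L (A ⇒' B) → Hilbert L (◇ A ⇒' ◇ B)
  axN□ : hasN L → Hilbert L (□ ⊤')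
  axP◇ : hasP L → Hilbert L (◇ ⊤')
  axC□ : hasC L → ∀ A B → Hilbert L (□ A ∧' □ B ⇒' □ (A ∧' B))
  axK◇ : hasC L → ∀ A B → Hilbert L (□ (A ⇒' B) ⇒' (◇ A ⇒' ◇ B))
  axD  : hasD L → ∀ A → Hilbert L (□ A ⇒' ◇ A)
  axT□ : hasT L → ∀ A → Hilbert L (□ A ⇒' A)
  axT◇ : hasT L → ∀ A → Hilbert L (A ⇒' ◇ A)

ruleM ruleN ruleP ruleC ruleK ruleD ruleCD ruleT : Logic → Set
ruleM MM = Unit
ruleM MMP = Unit
ruleM MMN = Unit
ruleM MMNP = Unit
ruleM MMD = Unit
ruleM MMT = Unit
ruleM MMND = Unit
ruleM MMNT = Unit
ruleM _ = ⊥

ruleN MMN = Unit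
ruleN MMNP = Unit
ruleN MMND = Unit
ruleN MMNT = Unit
ruleN _ = ⊥

ruleP MMP = Unit
ruleP MMNP = Unit
ruleP MMD = Unit
ruleP MMND = Unit
ruleP _ = ⊥

ruleC MMC = Unit
ruleC MMCD = Unit
ruleC MMCT = Unit
ruleC _ = ⊥

ruleK MK = Unit
ruleK MKD = Unit
ruleK MKT = Unit
ruleK _ = ⊥

-- K◇ is present exactly in the calculi with C□ or K□ (see sequent rule below)

ruleD MMD = Unit
ruleD MMND = Unit
ruleD _ = ⊥

ruleCD MMCD = Unit
ruleCD MKD = Unit
ruleCD _ = ⊥

ruleT MMT = Unit
ruleT MMNT = Unit
ruleT MMCT = Unit
ruleT MKT = Unit
ruleT _ = ⊥

-- Contexts are finite multisets, represented as lists taken up to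
-- permutation (rule `perm`). Γ , A is written A ∷ Γ.
Ctx : Set
Ctx = List Formula

infix 2 _⊢_⇒_
data _⊢_⇒_ (L : Logic) : Ctx → Formula → Set where
  init : ∀ A → L ⊢ A ∷ [] ⇒ A
  perm : ∀ {Γ Δ C} → Γ ↭ Δ → L ⊢ Γ ⇒ C → L ⊢ Δ ⇒ C
  L∧₁ : ∀ {Γ A B C} → L ⊢ A ∷ Γ ⇒ C → L ⊢ (A ∧' B) ∷ Γ ⇒ C
  L∧₂ : ∀ {Γ A B C} → L ⊢ B ∷ Γ ⇒ C → L ⊢ (A ∧' B) ∷ Γ ⇒ C
  R∧  : ∀ {Γ A B} → L ⊢ Γ ⇒ A → L ⊢ Γ ⇒ B → L ⊢ Γ ⇒ A ∧' B
  L∨  : ∀ {Γ A B C} → L ⊢ A ∷ Γ ⇒ C → L ⊢ B ∷ Γ ⇒ C → L ⊢ (A ∨' B) ∷ Γ ⇒ C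
  R∨₁ : ∀ {Γ A B} → L ⊢ Γ ⇒ A → L ⊢ Γ ⇒ A ∨' B
  R∨₂ : ∀ {Γ A B} → L ⊢ Γ ⇒ B → L ⊢ Γ ⇒ A ∨' B
  R→  : ∀ {Γ A B} → L ⊢ A ∷ Γ ⇒ B → L ⊢ Γ ⇒ A ⇒' B
  L→  : ∀ {Γ A B C} → L ⊢ Γ ⇒ A → L ⊢ B ∷ Γ ⇒ C → L ⊢ (A ⇒' B) ∷ Γ ⇒ C
  LW  : ∀ {Γ A C} → L ⊢ Γ ⇒ C → L ⊢ A ∷ Γ ⇒ C
  LC  : ∀ {Γ A C} → L ⊢ A ∷ A ∷ Γ ⇒ C → L ⊢ A ∷ Γ ⇒ C
  M□  : ruleM L → ∀ {A B} → L ⊢ A ∷ [] ⇒ B → L ⊢ □ A ∷ [] ⇒ □ B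
  M◇  : ruleM L → ∀ {A B} → L ⊢ A ∷ [] ⇒ B → L ⊢ ◇ A ∷ [] ⇒ ◇ B
  N□  : ruleN L → ∀ {A} → L ⊢ [] ⇒ A → L ⊢ [] ⇒ □ A
  C□  : ruleC L → ∀ {Σ A B} → L ⊢ A ∷ Σ ⇒ B → L ⊢ □ A ∷ map □ Σ ⇒ □ B
  K□  : ruleK L → ∀ {Σ A} → L ⊢ Σ ⇒ A → L ⊢ map □ Σ ⇒ □ A
  K◇C : ruleC L → ∀ {Σ A B} → L ⊢ A ∷ Σ ⇒ B → L ⊢ ◇ A ∷ map □ Σ ⇒ ◇ B
  K◇K : ruleK L → ∀ {Σ A B} → L ⊢ A ∷ Σ ⇒ B → L ⊢ ◇ A ∷ map □ Σ ⇒ ◇ B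
  P◇  : ruleP L → ∀ {A} → L ⊢ [] ⇒ A → L ⊢ [] ⇒ ◇ A
  D   : ruleD L → ∀ {A B} → L ⊢ A ∷ [] ⇒ B → L ⊢ □ A ∷ [] ⇒ ◇ B
  CD  : ruleCD L → ∀ {Σ A} → L ⊢ Σ ⇒ A → L ⊢ map □ Σ ⇒ ◇ A
  T□  : ruleT L → ∀ {Γ A C} → L ⊢ A ∷ Γ ⇒ C → L ⊢ □ A ∷ Γ ⇒ C
  T◇  : ruleT L → ∀ {Γ A} → L ⊢ Γ ⇒ A → L ⊢ Γ ⇒ ◇ A

-- Soundness reads a sequent Γ ⇒ C as the implication ⋀Γ → C. Completeness derives every
-- axiom of MX without cut and simulates modus ponens by cut, so it rests on cut
-- admissibility, proved in the context-sharing form: from Γ ⇒ A and Δ ⇒ C with Γ ⊆ Θ and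
-- Δ ⊆ A ∷ Θ infer Θ ⇒ C. Sharing Θ absorbs contraction, so induction on A, then on the
-- left and then on the right derivation goes through. Every right modal rule concludes
-- □Σ ⇒ □A, ◇A,□Σ ⇒ ◇B or □Σ ⇒ ◇A from its unboxed premise; a principal cut on □Z merges
-- the boxed contexts of the two premises, and the merged context is again admissible for
-- the rule because no calculus mixes the monotone rules M□, N□, P◇, D with the regular
-- ones C□, K□, K◇, CD.
module Submission where

open import Data.Empty using (⊥; ⊥-elim)
open import Data.List using ([]; _∷_; [_]; _++_; map)
open import Data.List.Properties using (map-++)
open import Data.List.Membership.Propositional using (_∈_)
open import Data.List.Membership.Propositional.Properties using (∈-∃++; ∈-++⁺ʳ; ∈-++⁻; ∈-map⁻)
open import Data.List.Relation.Unary.Any using (here; there)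
open import Data.List.Relation.Binary.Subset.Propositional using (_⊆_)
open import Data.List.Relation.Binary.Subset.Propositional.Properties
  using (⊆-refl; ⊆-trans; ⊆-reflexive; xs⊆x∷xs; ∷⁺ʳ; ∈-∷⁺ʳ; xs⊆xs++ys; xs⊆ys++xs)
import Data.List.Relation.Binary.Permutation.Propositional as ↭
open import Data.List.Relation.Binary.Permutation.Propositional using (_↭_; ↭-sym)
open import Data.List.Relation.Binary.Permutation.Propositional.Properties
  using (shift; ++-comm; ∈-resp-↭)
open import Data.Product using (_×_; _,_; proj₁; proj₂; ∃-syntax)
open import Data.Sum using (_⊎_; inj₁; inj₂)
open import Data.Unit using (⊤; tt)
open import Function using (_∘_)
open import Function.Bundles using (_⇔_; mk⇔)
open import Relation.Binary.PropositionalEquality using (refl)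
open import Relation.Nullary using (Dec; yes; no; ¬_)

open import Defs

private variable
  L : Logic
  A B C X Z : Formula
  Γ Δ Θ Σ Π Ξ : Ctx

weaken-++ : ∀ Δ → L ⊢ Γ ⇒ C → L ⊢ Δ ++ Γ ⇒ C
weaken-++ []      d = d
weaken-++ (_ ∷ Δ) d = LW (weaken-++ Δ d)

absorb : X ∈ Θ → L ⊢ X ∷ Θ ⇒ C → L ⊢ Θ ⇒ C
absorb {X = X} X∈Θ d with ∈-∃++ X∈Θ
... | Θ₁ , Θ₂ , refl =
  perm (↭-sym (shift X Θ₁ Θ₂)) (LC (perm (↭.prep X (shift X Θ₁ Θ₂)) d))

absorb-++ : ∀ Γ → Γ ⊆ Δ → L ⊢ Γ ++ Δ ⇒ C → L ⊢ Δ ⇒ C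
absorb-++ []      _   d = d
absorb-++ (X ∷ Γ) Γ⊆Δ d =
  absorb-++ Γ (Γ⊆Δ ∘ there) (absorb (∈-++⁺ʳ Γ (Γ⊆Δ (here refl))) d)

weaken-⊆ : Γ ⊆ Δ → L ⊢ Γ ⇒ C → L ⊢ Δ ⇒ C
weaken-⊆ {Γ} {Δ} Γ⊆Δ d = absorb-++ Γ Γ⊆Δ (perm (++-comm Δ Γ) (weaken-++ Δ d))

T□-map : ruleT L → ∀ Σ → L ⊢ Σ ++ Θ ⇒ C → L ⊢ map □ Σ ++ Θ ⇒ C
T□-map t []          d = d
T□-map {Θ = Θ} t (X ∷ Σ) d =
  T□ t (perm (shift X (map □ Σ) Θ) (T□-map t Σ (perm (↭-sym (shift X Σ Θ)) d)))

[_]⊆ : X ∈ Θ → [ X ] ⊆ Θ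
[ X∈Θ ]⊆ = ∈-∷⁺ʳ X∈Θ (λ ())

++-⊆ : Γ ⊆ Θ → Δ ⊆ Θ → Γ ++ Δ ⊆ Θ
++-⊆ {Γ} Γ⊆Θ Δ⊆Θ m with ∈-++⁻ Γ m
... | inj₁ m′ = Γ⊆Θ m′
... | inj₂ m′ = Δ⊆Θ m′

map□-++-⊆ : map □ Σ ⊆ Θ → map □ Π ⊆ Θ → map □ (Σ ++ Π) ⊆ Θ
map□-++-⊆ {Σ} {Π = Π} Σ⊆Θ Π⊆Θ = ⊆-trans (⊆-reflexive (map-++ □ Σ Π)) (++-⊆ Σ⊆Θ Π⊆Θ)

under : Δ ⊆ A ∷ Θ → Δ ⊆ A ∷ X ∷ Θ
under {A = A} {Θ} {X} h = ⊆-trans h (∷⁺ʳ A (xs⊆x∷xs Θ X))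

extend : Δ ⊆ A ∷ Θ → X ∷ Δ ⊆ A ∷ X ∷ Θ
extend h (here refl) = there (here refl)
extend h (there m)   = under h m

data IsBox : Formula → Set where
  box : ∀ Z → IsBox (□ Z)

isBox? : ∀ A → Dec (IsBox A)
isBox? (□ Z)    = yes (box Z)
isBox? (var _)  = no λ ()
isBox? ⊥'       = no λ ()
isBox? (_ ∧' _) = no λ ()
isBox? (_ ∨' _) = no λ ()
isBox? (_ ⇒' _) = no λ ()
isBox? (◇ _)    = no λ ()

map□-⊆-nonbox : ¬ IsBox A → map □ Π ⊆ A ∷ Θ → map □ Π ⊆ Θ
map□-⊆-nonbox ¬□ h m with ∈-map⁻ □ m
... | Z , _ , refl with h m
...   | here refl = ⊥-elim (¬□ (box Z))
...   | there m′  = m′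

□-split : ∀ Π → map □ Π ⊆ □ Z ∷ Θ → ∃[ R ] Π ⊆ Z ∷ R × map □ R ⊆ Θ
□-split []      h = [] , (λ ()) , (λ ())
□-split (X ∷ Π) h with □-split Π (h ∘ there) | h (here refl)
... | R , Π⊆ZR , R⊆Θ | here refl  = R , ∈-∷⁺ʳ (here refl) Π⊆ZR , R⊆Θ
... | R , Π⊆ZR , R⊆Θ | there □X∈Θ = X ∷ R , ∈-∷⁺ʳ (there (here refl)) (under Π⊆ZR) , ∈-∷⁺ʳ □X∈Θ R⊆Θ

ruleK◇ : Logic → Set
ruleK◇ L = ruleC L ⊎ ruleK L

ruleM⊎ruleK◇ : ∀ L → ruleM L ⊎ ruleK◇ L
ruleM⊎ruleK◇ MM   = inj₁ tt
ruleM⊎ruleK◇ MMP  = inj₁ tt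
ruleM⊎ruleK◇ MMN  = inj₁ tt
ruleM⊎ruleK◇ MMNP = inj₁ tt
ruleM⊎ruleK◇ MMD  = inj₁ tt
ruleM⊎ruleK◇ MMT  = inj₁ tt
ruleM⊎ruleK◇ MMND = inj₁ tt
ruleM⊎ruleK◇ MMNT = inj₁ tt
ruleM⊎ruleK◇ MMC  = inj₂ (inj₁ tt)
ruleM⊎ruleK◇ MMCD = inj₂ (inj₁ tt)
ruleM⊎ruleK◇ MMCT = inj₂ (inj₁ tt)
ruleM⊎ruleK◇ MK   = inj₂ (inj₂ tt)
ruleM⊎ruleK◇ MKD  = inj₂ (inj₂ tt)
ruleM⊎ruleK◇ MKT  = inj₂ (inj₂ tt)

ruleM-ruleK◇-disjoint : ruleM L → ruleK◇ L → ⊥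
ruleM-ruleK◇-disjoint {MM} _ (inj₁ ())
ruleM-ruleK◇-disjoint {MM} _ (inj₂ ())

ruleN⇒ruleM : ruleN L → ruleM L
ruleN⇒ruleM {MMN}  _ = tt
ruleN⇒ruleM {MMNP} _ = tt
ruleN⇒ruleM {MMND} _ = tt
ruleN⇒ruleM {MMNT} _ = tt

ruleP⇒ruleM : ruleP L → ruleM L
ruleP⇒ruleM {MMP}  _ = tt
ruleP⇒ruleM {MMNP} _ = tt
ruleP⇒ruleM {MMD}  _ = tt
ruleP⇒ruleM {MMND} _ = tt

ruleD⇒ruleP : ruleD L → ruleP L
ruleD⇒ruleP {MMD}  _ = tt
ruleD⇒ruleP {MMND} _ = tt

ruleN⇒hasN : ruleN L → hasN L
ruleN⇒hasN {MMN}  _ = tt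
ruleN⇒hasN {MMNP} _ = tt
ruleN⇒hasN {MMND} _ = tt
ruleN⇒hasN {MMNT} _ = tt

ruleK⇒hasN : ruleK L → hasN L
ruleK⇒hasN {MK}  _ = tt
ruleK⇒hasN {MKD} _ = tt
ruleK⇒hasN {MKT} _ = tt

ruleC⇒hasC : ruleC L → hasC L
ruleC⇒hasC {MMC}  _ = tt
ruleC⇒hasC {MMCD} _ = tt
ruleC⇒hasC {MMCT} _ = tt

ruleK⇒hasC : ruleK L → hasC L
ruleK⇒hasC {MK}  _ = tt
ruleK⇒hasC {MKD} _ = tt
ruleK⇒hasC {MKT} _ = tt

ruleCD⇒hasC : ruleCD L → hasC L
ruleCD⇒hasC {MMCD} _ = tt
ruleCD⇒hasC {MKD}  _ = tt

ruleD⇒hasD : ruleD L → hasD L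
ruleD⇒hasD {MMD}  _ = tt
ruleD⇒hasD {MMND} _ = tt

ruleCD⇒hasD : ruleCD L → hasD L
ruleCD⇒hasD {MMCD} _ = tt
ruleCD⇒hasD {MKD}  _ = tt

ruleT⇒hasT : ruleT L → hasT L
ruleT⇒hasT {MMT}  _ = tt
ruleT⇒hasT {MMNT} _ = tt
ruleT⇒hasT {MMCT} _ = tt
ruleT⇒hasT {MKT}  _ = tt

hasN⇒ruleN⊎ruleK : hasN L → ruleN L ⊎ ruleK L
hasN⇒ruleN⊎ruleK {MMN}  _ = inj₁ tt
hasN⇒ruleN⊎ruleK {MMNP} _ = inj₁ tt
hasN⇒ruleN⊎ruleK {MMND} _ = inj₁ tt
hasN⇒ruleN⊎ruleK {MMNT} _ = inj₁ tt
hasN⇒ruleN⊎ruleK {MK}   _ = inj₂ tt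
hasN⇒ruleN⊎ruleK {MKD}  _ = inj₂ tt
hasN⇒ruleN⊎ruleK {MKT}  _ = inj₂ tt

hasP⇒ruleP⊎ruleCD : hasP L → ruleP L ⊎ ruleCD L
hasP⇒ruleP⊎ruleCD {MMP}  _ = inj₁ tt
hasP⇒ruleP⊎ruleCD {MMNP} _ = inj₁ tt
hasP⇒ruleP⊎ruleCD {MMD}  _ = inj₁ tt
hasP⇒ruleP⊎ruleCD {MMCD} _ = inj₂ tt

hasC⇒ruleK◇ : hasC L → ruleK◇ L
hasC⇒ruleK◇ {MMC}  _ = inj₁ tt
hasC⇒ruleK◇ {MMCD} _ = inj₁ tt
hasC⇒ruleK◇ {MMCT} _ = inj₁ tt
hasC⇒ruleK◇ {MK}   _ = inj₂ tt
hasC⇒ruleK◇ {MKD}  _ = inj₂ tt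
hasC⇒ruleK◇ {MKT}  _ = inj₂ tt

hasD⇒ruleD⊎ruleCD : hasD L → ruleD L ⊎ ruleCD L
hasD⇒ruleD⊎ruleCD {MMD}  _ = inj₁ tt
hasD⇒ruleD⊎ruleCD {MMND} _ = inj₁ tt
hasD⇒ruleD⊎ruleCD {MMCD} _ = inj₂ tt
hasD⇒ruleD⊎ruleCD {MKD}  _ = inj₂ tt

hasT⇒ruleT : hasT L → ruleT L
hasT⇒ruleT {MMT}  _ = tt
hasT⇒ruleT {MMNT} _ = tt
hasT⇒ruleT {MMCT} _ = tt
hasT⇒ruleT {MKT}  _ = tt

⋀ : Ctx → Formula
⋀ []      = ⊤'
⋀ (A ∷ Γ) = A ∧' ⋀ Γ

module _ {L : Logic} where

  private
    H : Formula → Set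
    H = Hilbert L

  ⇒-const : H B → H (A ⇒' B)
  ⇒-const = mp (ax8 _ _)

  ⇒-ap : H (A ⇒' (B ⇒' C)) → H (A ⇒' B) → H (A ⇒' C)
  ⇒-ap f g = mp (mp (ax7 _ _ _) f) g

  ⇒-refl : H (A ⇒' A)
  ⇒-refl {A} = ⇒-ap (ax8 A (A ⇒' A)) (ax8 A A)

  ⇒-trans : H (A ⇒' B) → H (B ⇒' C) → H (A ⇒' C)
  ⇒-trans f g = ⇒-ap (⇒-const g) f

  ⊤'-intro : H ⊤'
  ⊤'-intro = ⇒-refl

  ⟨_,_⟩ : H (A ⇒' B) → H (A ⇒' C) → H (A ⇒' B ∧' C)
  ⟨ f , g ⟩ = mp (mp (ax5 _ _ _) f) g

  ∧-swap : H (A ∧' B ⇒' B ∧' A)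
  ∧-swap = ⟨ ax2 _ _ , ax1 _ _ ⟩

  ∧-uncurry : H (A ⇒' (B ⇒' C)) → H (A ∧' B ⇒' C)
  ∧-uncurry f = ⇒-ap (⇒-trans (ax1 _ _) f) (ax2 _ _)

  ∧-curry : H (A ∧' B ⇒' C) → H (A ⇒' (B ⇒' C))
  ∧-curry {A} {B} f = ⇒-trans ∧-pair (mp (ax7 _ _ _) (⇒-const f))
    where
      ∧-pair : H (A ⇒' (B ⇒' A ∧' B))
      ∧-pair = ⇒-ap (⇒-trans (ax8 A B) (ax5 B A B)) (⇒-const ⇒-refl)

  ⋀-↭ : Γ ↭ Δ → H (⋀ Γ ⇒' ⋀ Δ)
  ⋀-↭ ↭.refl         = ⇒-refl
  ⋀-↭ (↭.prep _ p)   = ⟨ ax1 _ _ , ⇒-trans (ax2 _ _) (⋀-↭ p) ⟩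
  ⋀-↭ (↭.swap _ _ p) =
    ⟨ ⇒-trans (ax2 _ _) (ax1 _ _) , ⟨ ax1 _ _ , ⇒-trans (ax2 _ _) (⇒-trans (ax2 _ _) (⋀-↭ p)) ⟩ ⟩
  ⋀-↭ (↭.trans p q)  = ⇒-trans (⋀-↭ p) (⋀-↭ q)

  ⋀[-]⁺ : H (A ⇒' B) → H (⋀ [ A ] ⇒' B)
  ⋀[-]⁺ = ⇒-trans (ax1 _ _)

  ⋀[-]⁻ : H (⋀ [ A ] ⇒' B) → H (A ⇒' B)
  ⋀[-]⁻ = ⇒-trans ⟨ ⇒-refl , ⇒-const ⊤'-intro ⟩

  C□-⋀ : hasC L → ∀ A Σ → H (⋀ (map □ (A ∷ Σ)) ⇒' □ (⋀ (A ∷ Σ)))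
  C□-⋀ c A []      = ⋀[-]⁺ (mon□ ⟨ ⇒-refl , ⇒-const ⊤'-intro ⟩)
  C□-⋀ c A (B ∷ Σ) = ⇒-trans ⟨ ax1 _ _ , ⇒-trans (ax2 _ _) (C□-⋀ c B Σ) ⟩ (axC□ c A (B ∧' ⋀ Σ))

  N□C□-⋀ : hasN L → hasC L → ∀ Σ → H (⋀ (map □ Σ) ⇒' □ (⋀ Σ))
  N□C□-⋀ n c []      = ⇒-const (axN□ n)
  N□C□-⋀ n c (A ∷ Σ) = C□-⋀ c A Σ

  K◇-⋀ : hasC L → ∀ Σ → H (⋀ (A ∷ Σ) ⇒' B) → H (⋀ (◇ A ∷ map □ Σ) ⇒' ◇ B)
  K◇-⋀ c []      f = ⋀[-]⁺ (mon◇ (⋀[-]⁻ f))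
  K◇-⋀ {A} {B} c (X ∷ Σ) f = ⇒-trans ∧-swap
    (∧-uncurry (⇒-trans (C□-⋀ c X Σ) (⇒-trans (mon□ (∧-curry (⇒-trans ∧-swap f))) (axK◇ c A B))))

ruleP⇒◇⊤ : ruleP L → Hilbert L (◇ ⊤')
ruleP⇒◇⊤ {MMP}  _ = axP◇ tt
ruleP⇒◇⊤ {MMNP} _ = axP◇ tt
ruleP⇒◇⊤ {MMD}  _ = axP◇ tt
ruleP⇒◇⊤ {MMND} _ = mp (axD tt ⊤') (axN□ tt)

ruleCD⇒◇⊤ : ruleCD L → Hilbert L (◇ ⊤')
ruleCD⇒◇⊤ {MMCD} _ = axP◇ tt
ruleCD⇒◇⊤ {MKD}  _ = mp (axD tt ⊤') (axN□ tt)

-- Soundness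

sound : L ⊢ Γ ⇒ C → Hilbert L (⋀ Γ ⇒' C)
sound (init _)   = ax1 _ _
sound (perm p d) = ⇒-trans (⋀-↭ (↭-sym p)) (sound d)
sound (L∧₁ d)    = ⇒-trans ⟨ ⇒-trans (ax1 _ _) (ax1 _ _) , ax2 _ _ ⟩ (sound d)
sound (L∧₂ d)    = ⇒-trans ⟨ ⇒-trans (ax1 _ _) (ax2 _ _) , ax2 _ _ ⟩ (sound d)
sound (R∧ d e)   = ⟨ sound d , sound e ⟩
sound (L∨ d e)   = ∧-uncurry (mp (mp (ax6 _ _ _) (∧-curry (sound d))) (∧-curry (sound e)))
sound (R∨₁ d)    = ⇒-trans (sound d) (ax3 _ _)
sound (R∨₂ d)    = ⇒-trans (sound d) (ax4 _ _)
sound (R→ d)     = ∧-curry (⇒-trans ∧-swap (sound d))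
sound (L→ d e)   = ⇒-trans ⟨ ⇒-ap (ax1 _ _) (⇒-trans (ax2 _ _) (sound d)) , ax2 _ _ ⟩ (sound e)
sound (LW d)     = ⇒-trans (ax2 _ _) (sound d)
sound (LC d)     = ⇒-trans ⟨ ax1 _ _ , ⇒-refl ⟩ (sound d)
sound (M□ _ d)   = ⋀[-]⁺ (mon□ (⋀[-]⁻ (sound d)))
sound (M◇ _ d)   = ⋀[-]⁺ (mon◇ (⋀[-]⁻ (sound d)))
sound (N□ ρ d)   = ⇒-const (mp (mon□ (sound d)) (axN□ (ruleN⇒hasN ρ)))
sound (C□ ρ {Σ} {A} d) = ⇒-trans (C□-⋀ (ruleC⇒hasC ρ) A Σ) (mon□ (sound d))
sound (K□ ρ {Σ} d) =
  ⇒-trans (N□C□-⋀ (ruleK⇒hasN ρ) (ruleK⇒hasC ρ) Σ) (mon□ (sound d))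
sound (K◇C ρ {Σ} d) = K◇-⋀ (ruleC⇒hasC ρ) Σ (sound d)
sound (K◇K ρ {Σ} d) = K◇-⋀ (ruleK⇒hasC ρ) Σ (sound d)
sound (P◇ ρ d)   = ⇒-const (mp (mon◇ (sound d)) (ruleP⇒◇⊤ ρ))
sound (D ρ d)    = ⋀[-]⁺ (⇒-trans (axD (ruleD⇒hasD ρ) _) (mon◇ (⋀[-]⁻ (sound d))))
sound (CD ρ {[]} d) = ⇒-const (mp (mon◇ (sound d)) (ruleCD⇒◇⊤ ρ))
sound (CD ρ {A ∷ Σ} d) =
  ⇒-trans (C□-⋀ (ruleCD⇒hasC ρ) A Σ)
          (⇒-trans (axD (ruleCD⇒hasD ρ) _) (mon◇ (sound d)))
sound (T□ ρ d)   = ⇒-trans ⟨ ⇒-trans (ax1 _ _) (axT□ (ruleT⇒hasT ρ) _) , ax2 _ _ ⟩ (sound d)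
sound (T◇ ρ d)   = ⇒-trans (sound d) (axT◇ (ruleT⇒hasT ρ) _)

-- Cut admissibility

data □Rule (L : Logic) : Ctx → Set where
  viaM□ : ruleM L → □Rule L [ A ]
  viaN□ : ruleN L → □Rule L []
  viaC□ : ruleC L → □Rule L (A ∷ Σ)
  viaK□ : ruleK L → □Rule L Σ

data ◇Rule (L : Logic) : Ctx → Set where
  viaM◇ : ruleM L → ◇Rule L []
  viaK◇ : ruleK◇ L → ◇Rule L Σ

data □◇Rule (L : Logic) : Ctx → Set where
  viaP◇ : ruleP L → □◇Rule L []
  viaD  : ruleD L → □◇Rule L [ A ]
  viaCD : ruleCD L → □◇Rule L Σ

□-rule : □Rule L Σ → L ⊢ Σ ⇒ A → L ⊢ map □ Σ ⇒ □ A
□-rule (viaM□ ρ) = M□ ρ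
□-rule (viaN□ ρ) = N□ ρ
□-rule (viaC□ ρ) = C□ ρ
□-rule (viaK□ ρ) = K□ ρ

◇-rule : ◇Rule L Σ → L ⊢ A ∷ Σ ⇒ B → L ⊢ ◇ A ∷ map □ Σ ⇒ ◇ B
◇-rule (viaM◇ ρ)        = M◇ ρ
◇-rule (viaK◇ (inj₁ ρ)) = K◇C ρ
◇-rule (viaK◇ (inj₂ ρ)) = K◇K ρ

□◇-rule : □◇Rule L Σ → L ⊢ Σ ⇒ A → L ⊢ map □ Σ ⇒ ◇ A
□◇-rule (viaP◇ ρ) = P◇ ρ
□◇-rule (viaD ρ)  = D ρ
□◇-rule (viaCD ρ) = CD ρ

□Rule-++ : ruleK◇ L → □Rule L Σ → ∀ Π → □Rule L (Σ ++ Π)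
□Rule-++ κ (viaM□ ρ) _ = ⊥-elim (ruleM-ruleK◇-disjoint ρ κ)
□Rule-++ κ (viaN□ ρ) _ = ⊥-elim (ruleM-ruleK◇-disjoint (ruleN⇒ruleM ρ) κ)
□Rule-++ κ (viaC□ ρ) _ = viaC□ ρ
□Rule-++ κ (viaK□ ρ) _ = viaK□ ρ

□◇Rule-++ : ruleK◇ L → □◇Rule L Σ → ∀ Π → □◇Rule L (Σ ++ Π)
□◇Rule-++ κ (viaP◇ ρ) _ = ⊥-elim (ruleM-ruleK◇-disjoint (ruleP⇒ruleM ρ) κ)
□◇Rule-++ κ (viaD ρ)  _ = ⊥-elim (ruleM-ruleK◇-disjoint (ruleP⇒ruleM (ruleD⇒ruleP ρ)) κ)
□◇Rule-++ κ (viaCD ρ) _ = viaCD ρ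

□Rule⇒□◇Rule : ruleD L → □Rule L Σ → □◇Rule L Σ
□Rule⇒□◇Rule δ (viaM□ _) = viaD δ
□Rule⇒□◇Rule δ (viaN□ _) = viaP◇ (ruleD⇒ruleP δ)
□Rule⇒□◇Rule δ (viaC□ ρ) = ⊥-elim (ruleM-ruleK◇-disjoint (ruleP⇒ruleM (ruleD⇒ruleP δ)) (inj₁ ρ))
□Rule⇒□◇Rule δ (viaK□ ρ) = ⊥-elim (ruleM-ruleK◇-disjoint (ruleP⇒ruleM (ruleD⇒ruleP δ)) (inj₂ ρ))

data RightIntro (L : Logic) : Ctx → Formula → Set where
  ∧-intro  : L ⊢ Γ ⇒ A → L ⊢ Γ ⇒ B → RightIntro L Γ (A ∧' B)
  ∨-intro₁ : L ⊢ Γ ⇒ A → RightIntro L Γ (A ∨' B)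
  ∨-intro₂ : L ⊢ Γ ⇒ B → RightIntro L Γ (A ∨' B)
  ⇒-intro  : L ⊢ A ∷ Γ ⇒ B → RightIntro L Γ (A ⇒' B)
  □-intro  : □Rule L Σ → L ⊢ Σ ⇒ A → RightIntro L (map □ Σ) (□ A)
  ◇-intro  : ◇Rule L Σ → L ⊢ A ∷ Σ ⇒ B → RightIntro L (◇ A ∷ map □ Σ) (◇ B)
  □◇-intro : □◇Rule L Σ → L ⊢ Σ ⇒ A → RightIntro L (map □ Σ) (◇ A)
  T◇-intro : ruleT L → L ⊢ Γ ⇒ A → RightIntro L Γ (◇ A)

fromIntro : RightIntro L Γ A → L ⊢ Γ ⇒ A
fromIntro (∧-intro d e)  = R∧ d e
fromIntro (∨-intro₁ d)   = R∨₁ d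
fromIntro (∨-intro₂ d)   = R∨₂ d
fromIntro (⇒-intro d)    = R→ d
fromIntro (□-intro r d)  = □-rule r d
fromIntro (◇-intro r d)  = ◇-rule r d
fromIntro (□◇-intro r d) = □◇-rule r d
fromIntro (T◇-intro t d) = T◇ t d

Cut : Formula → Set
Cut A = ∀ {L Γ Δ Θ C} → L ⊢ Γ ⇒ A → L ⊢ Δ ⇒ C → Γ ⊆ Θ → Δ ⊆ A ∷ Θ → L ⊢ Θ ⇒ C

CutBelow : Formula → Set
CutBelow (A ∧' B) = Cut A × Cut B
CutBelow (A ∨' B) = Cut A × Cut B
CutBelow (A ⇒' B) = Cut A × Cut B
CutBelow (□ A)    = Cut A
CutBelow (◇ A)    = Cut A
CutBelow (var _)  = ⊤
CutBelow ⊥'       = ⊤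

◇-principal-M◇ : Cut X → RightIntro L Γ (◇ X) → L ⊢ [ X ] ⇒ B → L ⊢ Γ ⇒ ◇ B
◇-principal-M◇ cutX (◇-intro r d)  e = ◇-rule r (cutX d e ⊆-refl [ here refl ]⊆)
◇-principal-M◇ cutX (□◇-intro r d) e = □◇-rule r (cutX d e ⊆-refl [ here refl ]⊆)
◇-principal-M◇ cutX (T◇-intro t d) e = T◇ t (cutX d e ⊆-refl [ here refl ]⊆)

◇-principal-K◇ : Cut X → ruleK◇ L → RightIntro L Γ (◇ X) → L ⊢ X ∷ Π ⇒ B →
                 Γ ⊆ Θ → map □ Π ⊆ Θ → L ⊢ Θ ⇒ ◇ B
◇-principal-K◇ {X = X} {Π = Π} cutX κ (◇-intro {Σ = Σ} {A = A} _ d) e s Π⊆Θ =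
  weaken-⊆ (∈-∷⁺ʳ (s (here refl)) (map□-++-⊆ (s ∘ there) Π⊆Θ))
    (◇-rule (viaK◇ κ) (cutX d e (xs⊆xs++ys (A ∷ Σ) Π) (∷⁺ʳ X (xs⊆ys++xs Π (A ∷ Σ)))))
◇-principal-K◇ {X = X} {Π = Π} cutX κ (□◇-intro {Σ = Σ} r d) e s Π⊆Θ =
  weaken-⊆ (map□-++-⊆ s Π⊆Θ)
    (□◇-rule (□◇Rule-++ κ r Π) (cutX d e (xs⊆xs++ys Σ Π) (∷⁺ʳ X (xs⊆ys++xs Π Σ))))
◇-principal-K◇ {X = X} {Γ = Γ} {Π = Π} cutX κ (T◇-intro t d) e s Π⊆Θ =
  weaken-⊆ (++-⊆ Π⊆Θ s)
    (T◇ t (T□-map t Π (cutX d e (xs⊆ys++xs Γ Π) (∷⁺ʳ X (xs⊆xs++ys Π Γ)))))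

module CutElimination (A : Formula) (cut-below : CutBelow A) where

  cut-in-boxes : RightIntro L Γ A → L ⊢ Ξ ++ Π ⇒ B → Γ ⊆ Θ → map □ Π ⊆ A ∷ Θ →
                 map □ Π ⊆ Θ ⊎ ∃[ Σ ] ∃[ R ] □Rule L Σ × map □ (Σ ++ R) ⊆ Θ × (L ⊢ Ξ ++ Σ ++ R ⇒ B)
  cut-in-boxes {Ξ = Ξ} {Π = Π} v e s h with isBox? A
  ... | no ¬□ = inj₁ (map□-⊆-nonbox ¬□ h)
  ... | yes (box Z) with v | □-split Π h
  ...   | □-intro {Σ = Σ} r d | R , Π⊆ZR , R⊆Θ =
    inj₂ (Σ , R , r , map□-++-⊆ s R⊆Θ , cut-below d e Σ⊆ Ξ++Π⊆)
    where
      Σ++R⊆ : Σ ++ R ⊆ Ξ ++ Σ ++ R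
      Σ++R⊆ = xs⊆ys++xs (Σ ++ R) Ξ
      Σ⊆ : Σ ⊆ Ξ ++ Σ ++ R
      Σ⊆ = ⊆-trans (xs⊆xs++ys Σ R) Σ++R⊆
      Ξ++Π⊆ : Ξ ++ Π ⊆ Z ∷ Ξ ++ Σ ++ R
      Ξ++Π⊆ = ++-⊆ (⊆-trans (xs⊆xs++ys Ξ (Σ ++ R)) (xs⊆x∷xs _ Z))
                   (⊆-trans Π⊆ZR (∷⁺ʳ Z (⊆-trans (xs⊆ys++xs R Σ) Σ++R⊆)))

  cut-K◇ : ruleK◇ L → RightIntro L Γ A → L ⊢ X ∷ Π ⇒ B → Γ ⊆ Θ →
           ◇ X ∷ map □ Π ⊆ A ∷ Θ → L ⊢ Θ ⇒ ◇ B
  cut-K◇ {X = X} {Π = Π} κ v e s h with h (here refl)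
  ... | here refl = ◇-principal-K◇ cut-below κ v e s (map□-⊆-nonbox (λ ()) (h ∘ there))
  ... | there ◇X∈Θ with cut-in-boxes {Ξ = [ X ]} {Π = Π} v e s (h ∘ there)
  ...   | inj₁ Π⊆Θ = weaken-⊆ (∈-∷⁺ʳ ◇X∈Θ Π⊆Θ) (◇-rule (viaK◇ κ) e)
  ...   | inj₂ (_ , _ , _ , Σ++R⊆Θ , d) = weaken-⊆ (∈-∷⁺ʳ ◇X∈Θ Σ++R⊆Θ) (◇-rule (viaK◇ κ) d)

  -- For a left rule of the right premise, h tells whether its principal formula is the cut
  -- formula or already lies in Θ; either way the copies of A in its premises are cut first.
  cut-intro : RightIntro L Γ A → L ⊢ Δ ⇒ C → Γ ⊆ Θ → Δ ⊆ A ∷ Θ → L ⊢ Θ ⇒ C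
  cut-intro v (init X) s h with h (here refl)
  ... | here refl = weaken-⊆ s (fromIntro v)
  ... | there X∈Θ = weaken-⊆ [ X∈Θ ]⊆ (init X)
  cut-intro v (perm p e) s h = cut-intro v e s (h ∘ ∈-resp-↭ p)
  cut-intro v (LW e)     s h = cut-intro v e s (h ∘ there)
  cut-intro v (LC e)     s h = cut-intro v e s (h ∘ ∈-∷⁺ʳ (here refl) ⊆-refl)
  cut-intro v (L∧₁ e) s h with h (here refl) | cut-intro v e (there ∘ s) (extend (h ∘ there))
  ... | there X∈Θ | r = absorb X∈Θ (L∧₁ r)
  ... | here refl | r with v
  ...   | ∧-intro d _ = proj₁ cut-below d r s ⊆-refl
  cut-intro v (L∧₂ e) s h with h (here refl) | cut-intro v e (there ∘ s) (extend (h ∘ there))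
  ... | there X∈Θ | r = absorb X∈Θ (L∧₂ r)
  ... | here refl | r with v
  ...   | ∧-intro _ d = proj₂ cut-below d r s ⊆-refl
  cut-intro v (L∨ e₁ e₂) s h
    with h (here refl)
       | cut-intro v e₁ (there ∘ s) (extend (h ∘ there))
       | cut-intro v e₂ (there ∘ s) (extend (h ∘ there))
  ... | there X∈Θ | r₁ | r₂ = absorb X∈Θ (L∨ r₁ r₂)
  ... | here refl | r₁ | r₂ with v
  ...   | ∨-intro₁ d = proj₁ cut-below d r₁ s ⊆-refl
  ...   | ∨-intro₂ d = proj₂ cut-below d r₂ s ⊆-refl
  cut-intro v (L→ e₁ e₂) s h
    with h (here refl)
       | cut-intro v e₁ s (h ∘ there)
       | cut-intro v e₂ (there ∘ s) (extend (h ∘ there))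
  ... | there X∈Θ | r₁ | r₂ = absorb X∈Θ (L→ r₁ r₂)
  ... | here refl | r₁ | r₂ with v
  ...   | ⇒-intro d =
    proj₂ cut-below (proj₁ cut-below r₁ d ⊆-refl (∷⁺ʳ _ s)) r₂ ⊆-refl ⊆-refl
  cut-intro {Θ = Θ} v (T□ t e) s h
    with h (here refl) | cut-intro v e (there ∘ s) (extend (h ∘ there))
  ... | there X∈Θ | r = absorb X∈Θ (T□ t r)
  ... | here refl | r with v
  ...   | □-intro {Σ = Σ} _ d =
    weaken-⊆ (++-⊆ s ⊆-refl)
      (T□-map t Σ (cut-below d r (xs⊆xs++ys Σ Θ) (∷⁺ʳ _ (xs⊆ys++xs Θ Σ))))
  cut-intro v (R∧ e₁ e₂) s h = R∧ (cut-intro v e₁ s h) (cut-intro v e₂ s h)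
  cut-intro v (R∨₁ e)    s h = R∨₁ (cut-intro v e s h)
  cut-intro v (R∨₂ e)    s h = R∨₂ (cut-intro v e s h)
  cut-intro v (R→ e)     s h = R→ (cut-intro v e (there ∘ s) (extend h))
  cut-intro v (T◇ t e)   s h = T◇ t (cut-intro v e s h)
  cut-intro v (N□ ρ e)   s h = weaken-⊆ (λ ()) (N□ ρ e)
  cut-intro v (P◇ ρ e)   s h = weaken-⊆ (λ ()) (P◇ ρ e)
  cut-intro v (M□ ρ e) s h with h (here refl)
  ... | there X∈Θ = weaken-⊆ [ X∈Θ ]⊆ (M□ ρ e)
  ... | here refl with v
  ...   | □-intro r d = weaken-⊆ s (□-rule r (cut-below d e ⊆-refl [ here refl ]⊆))
  cut-intro v (D δ e) s h with h (here refl)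
  ... | there X∈Θ = weaken-⊆ [ X∈Θ ]⊆ (D δ e)
  ... | here refl with v
  ...   | □-intro r d =
    weaken-⊆ s (□◇-rule (□Rule⇒□◇Rule δ r) (cut-below d e ⊆-refl [ here refl ]⊆))
  cut-intro v (M◇ ρ e) s h with h (here refl)
  ... | there X∈Θ = weaken-⊆ [ X∈Θ ]⊆ (M◇ ρ e)
  ... | here refl = weaken-⊆ s (◇-principal-M◇ cut-below v e)
  cut-intro v (C□ ρ {Π} {X} e) s h with cut-in-boxes {Ξ = []} {Π = X ∷ Π} v e s h
  ... | inj₁ Π⊆Θ = weaken-⊆ Π⊆Θ (C□ ρ e)
  ... | inj₂ (_ , R , r , Σ++R⊆Θ , d) = weaken-⊆ Σ++R⊆Θ (□-rule (□Rule-++ (inj₁ ρ) r R) d)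
  cut-intro v (K□ ρ {Π} e) s h with cut-in-boxes {Ξ = []} {Π = Π} v e s h
  ... | inj₁ Π⊆Θ = weaken-⊆ Π⊆Θ (K□ ρ e)
  ... | inj₂ (_ , R , r , Σ++R⊆Θ , d) = weaken-⊆ Σ++R⊆Θ (□-rule (□Rule-++ (inj₂ ρ) r R) d)
  cut-intro v (CD ρ {Π} e) s h with cut-in-boxes {Ξ = []} {Π = Π} v e s h
  ... | inj₁ Π⊆Θ = weaken-⊆ Π⊆Θ (CD ρ e)
  ... | inj₂ (_ , _ , _ , Σ++R⊆Θ , d) = weaken-⊆ Σ++R⊆Θ (CD ρ d)
  cut-intro v (K◇C ρ e) s h = cut-K◇ (inj₁ ρ) v e s h
  cut-intro v (K◇K ρ e) s h = cut-K◇ (inj₂ ρ) v e s h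

  cut : L ⊢ Γ ⇒ A → L ⊢ Δ ⇒ C → Γ ⊆ Θ → Δ ⊆ A ∷ Θ → L ⊢ Θ ⇒ C
  cut (init _)   e s h = weaken-⊆ (⊆-trans h (∈-∷⁺ʳ (s (here refl)) ⊆-refl)) e
  cut (perm p d) e s h = cut d e (s ∘ ∈-resp-↭ p) h
  cut (LW d)     e s h = cut d e (s ∘ there) h
  cut (LC d)     e s h = cut d e (∈-∷⁺ʳ (s (here refl)) s) h
  cut (L∧₁ d)    e s h = absorb (s (here refl)) (L∧₁ (cut d e (∷⁺ʳ _ (s ∘ there)) (under h)))
  cut (L∧₂ d)    e s h = absorb (s (here refl)) (L∧₂ (cut d e (∷⁺ʳ _ (s ∘ there)) (under h)))
  cut (T□ t d)   e s h = absorb (s (here refl)) (T□ t (cut d e (∷⁺ʳ _ (s ∘ there)) (under h)))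
  cut (L∨ d₁ d₂) e s h = absorb (s (here refl))
    (L∨ (cut d₁ e (∷⁺ʳ _ (s ∘ there)) (under h)) (cut d₂ e (∷⁺ʳ _ (s ∘ there)) (under h)))
  cut (L→ d₁ d₂) e s h = absorb (s (here refl))
    (L→ (weaken-⊆ (s ∘ there) d₁) (cut d₂ e (∷⁺ʳ _ (s ∘ there)) (under h)))
  cut (R∧ d₁ d₂) = cut-intro (∧-intro d₁ d₂)
  cut (R∨₁ d)    = cut-intro (∨-intro₁ d)
  cut (R∨₂ d)    = cut-intro (∨-intro₂ d)
  cut (R→ d)     = cut-intro (⇒-intro d)
  cut (M□ ρ d)   = cut-intro (□-intro (viaM□ ρ) d)
  cut (N□ ρ d)   = cut-intro (□-intro (viaN□ ρ) d)
  cut (C□ ρ d)   = cut-intro (□-intro (viaC□ ρ) d)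
  cut (K□ ρ d)   = cut-intro (□-intro (viaK□ ρ) d)
  cut (M◇ ρ d)   = cut-intro (◇-intro (viaM◇ ρ) d)
  cut (K◇C ρ d)  = cut-intro (◇-intro (viaK◇ (inj₁ ρ)) d)
  cut (K◇K ρ d)  = cut-intro (◇-intro (viaK◇ (inj₂ ρ)) d)
  cut (P◇ ρ d)   = cut-intro (□◇-intro (viaP◇ ρ) d)
  cut (D ρ d)    = cut-intro (□◇-intro (viaD ρ) d)
  cut (CD ρ d)   = cut-intro (□◇-intro (viaCD ρ) d)
  cut (T◇ ρ d)   = cut-intro (T◇-intro ρ d)

cut-admissible : ∀ A → Cut A
cut-admissible-below : ∀ A → CutBelow A

cut-admissible A = CutElimination.cut A (cut-admissible-below A)

cut-admissible-below (A ∧' B) = cut-admissible A , cut-admissible B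
cut-admissible-below (A ∨' B) = cut-admissible A , cut-admissible B
cut-admissible-below (A ⇒' B) = cut-admissible A , cut-admissible B
cut-admissible-below (□ A)    = cut-admissible A
cut-admissible-below (◇ A)    = cut-admissible A
cut-admissible-below (var _)  = tt
cut-admissible-below ⊥'       = tt

-- Completeness

hyp : A ∈ Γ → L ⊢ Γ ⇒ A
hyp A∈Γ = weaken-⊆ [ A∈Γ ]⊆ (init _)

mp-⊢ : L ⊢ Γ ⇒ A ⇒' B → L ⊢ Γ ⇒ A → L ⊢ Γ ⇒ B
mp-⊢ d e = cut-admissible _ d (L→ e (hyp (here refl))) ⊆-refl ⊆-refl

R→-inv : L ⊢ [] ⇒ A ⇒' B → L ⊢ [ A ] ⇒ B
R→-inv d = mp-⊢ (weaken-⊆ (λ ()) d) (init _)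

L∧ : L ⊢ A ∷ B ∷ Γ ⇒ C → L ⊢ A ∧' B ∷ Γ ⇒ C
L∧ d = LC (L∧₁ (perm (↭.swap _ _ ↭.refl) (L∧₂ (perm (↭.swap _ _ ↭.refl) d))))

⊢⊤ : L ⊢ [] ⇒ ⊤'
⊢⊤ = R→ (init ⊥')

C□-rule : ruleK◇ L → L ⊢ A ∷ Σ ⇒ B → L ⊢ □ A ∷ map □ Σ ⇒ □ B
C□-rule (inj₁ ρ) = C□ ρ
C□-rule (inj₂ ρ) = K□ ρ

M□-rule : L ⊢ [ A ] ⇒ B → L ⊢ [ □ A ] ⇒ □ B
M□-rule {L} with ruleM⊎ruleK◇ L
... | inj₁ ρ = M□ ρ
... | inj₂ κ = C□-rule κ

M◇-rule : L ⊢ [ A ] ⇒ B → L ⊢ [ ◇ A ] ⇒ ◇ B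
M◇-rule {L} with ruleM⊎ruleK◇ L
... | inj₁ ρ = M◇ ρ
... | inj₂ κ = ◇-rule (viaK◇ κ)

N□-rule : hasN L → L ⊢ [] ⇒ A → L ⊢ [] ⇒ □ A
N□-rule n with hasN⇒ruleN⊎ruleK n
... | inj₁ ρ = N□ ρ
... | inj₂ ρ = K□ ρ

P◇-rule : hasP L → L ⊢ [] ⇒ A → L ⊢ [] ⇒ ◇ A
P◇-rule p with hasP⇒ruleP⊎ruleCD p
... | inj₁ ρ = P◇ ρ
... | inj₂ ρ = CD ρ

D-rule : hasD L → L ⊢ [ A ] ⇒ B → L ⊢ [ □ A ] ⇒ ◇ B
D-rule δ with hasD⇒ruleD⊎ruleCD δ
... | inj₁ ρ = D ρ
... | inj₂ ρ = CD ρ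

complete : Hilbert L A → L ⊢ [] ⇒ A
complete (ax1 A B) = R→ (L∧₁ (init A))
complete (ax2 A B) = R→ (L∧₂ (init B))
complete (ax3 A B) = R→ (R∨₁ (init A))
complete (ax4 A B) = R→ (R∨₂ (init B))
complete (ax5 A B C) = R→ (R→ (R→ (R∧ (mp-⊢ (hyp (there (there (here refl)))) (hyp (here refl)))
                                       (mp-⊢ (hyp (there (here refl))) (hyp (here refl))))))
complete (ax6 A B C) = R→ (R→ (R→ (L∨ (mp-⊢ (hyp (there (there (here refl)))) (hyp (here refl)))
                                      (mp-⊢ (hyp (there (here refl))) (hyp (here refl))))))
complete (ax7 A B C) = R→ (R→ (R→ (mp-⊢ (mp-⊢ (hyp (there (there (here refl)))) (hyp (here refl)))
                                        (mp-⊢ (hyp (there (here refl))) (hyp (here refl))))))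
complete (ax8 A B) = R→ (R→ (hyp (there (here refl))))
complete (mp d e)  = mp-⊢ (complete d) (complete e)
complete (mon□ d)  = R→ (M□-rule (R→-inv (complete d)))
complete (mon◇ d)  = R→ (M◇-rule (R→-inv (complete d)))
complete (axN□ n)  = N□-rule n ⊢⊤
complete (axP◇ p)  = P◇-rule p ⊢⊤
complete (axC□ c A B) =
  R→ (L∧ (C□-rule (hasC⇒ruleK◇ c) (R∧ (hyp (here refl)) (hyp (there (here refl))))))
complete (axK◇ c A B) =
  R→ (R→ (◇-rule (viaK◇ (hasC⇒ruleK◇ c)) (mp-⊢ (hyp (there (here refl))) (hyp (here refl)))))
complete (axD δ A) = R→ (D-rule δ (init A))
complete (axT□ t A) = R→ (T□ (hasT⇒ruleT t) (init A))
complete (axT◇ t A) = R→ (T◇ (hasT⇒ruleT t) (init A))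

mainTheorem17 : (L : Logic) (A : Formula) → (L ⊢ [] ⇒ A) ⇔ Hilbert L A
mainTheorem17 L A = mk⇔ (λ d → mp (sound d) ⊤'-intro) complete
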